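{- Let $\mathbb{F}$ be a finite field with $n=|\mathbb{F}|$ elements and $R=M_2(\mathbb{F})$. Then the Wiener index of $G_{Id}(R)$ is $W(G_{Id}(R))=\frac{1}{2}(n^2+n)(2n^2-1)$ and its Harary index is $H(G_{Id}(R))=\frac{1}{2}(n^2+n)(n^2+3n-2)$.
   Context: For a ring $R$, $G_{Id}(R)$ is the simple graph whose vertices are the nontrivial idempotents of $R$ (idempotents other than $0$ and $1$), with distinct $h,k$ adjacent iff $hk=0$ or $kh=0$. For a connected graph $G$, $d_G(v)=\sum_{u\in V(G)}d(u,v)$ and $d'_G(v)=\sum_{u\in V(G),u\ne v}\frac{1}{d(u,v)}$. The Wiener index is $W(G)=\frac12\sum_{v\in V(G)}d_G(v)$ (the sum of distances over unordered pairs of vertices), and the Harary index is taken as $H(G)=\sum_{v\in V(G)}d'_G(v)$. -}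

module Defs where

open import Level using (0ℓ)
open import Algebra.Bundles using (CommutativeRing)
open import Data.Nat as ℕ using (ℕ; zero; suc; _≤_)
open import Data.Fin as Fin using (Fin)
open import Data.List as List using (List; length; lookup; allFin; map; foldr)
open import Data.List.Relation.Unary.Any using (Any)
open import Data.List.Relation.Unary.AllPairs using (AllPairs)
open import Data.Integer using (+_)
open import Data.Rational as ℚ using (ℚ; 0ℚ)
open import Data.Product using (Σ; ∃; _×_; _,_)
open import Data.Sum using (_⊎_)
open import Relation.Nullary using (¬_; does)
open import Relation.Binary.PropositionalEquality using (_≡_; _≢_)
open import Data.Bool using (if_then_else_)

record FiniteField : Set₁ where
  field
    cring : CommutativeRing 0ℓ 0ℓ
  open CommutativeRing cring public
  field
    0≉1      : ¬ (0# ≈ 1#)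
    inverse  : ∀ x → ¬ (x ≈ 0#) → ∃ λ y → x * y ≈ 1#
    elems    : List Carrier
    complete : ∀ x → Any (x ≈_) elems
    distinct : AllPairs (λ a b → ¬ (a ≈ b)) elems

  card : ℕ
  card = length elems

module Mat (F : FiniteField) where
  open FiniteField F

  record M₂ : Set where
    constructor mat
    field
      a₁₁ a₁₂ a₂₁ a₂₂ : Carrier
  open M₂ public

  _≈M_ : M₂ → M₂ → Set
  A ≈M B = (a₁₁ A ≈ a₁₁ B) × (a₁₂ A ≈ a₁₂ B) × (a₂₁ A ≈ a₂₁ B) × (a₂₂ A ≈ a₂₂ B)

  _·_ : M₂ → M₂ → M₂
  A · B = mat (a₁₁ A * a₁₁ B + a₁₂ A * a₂₁ B) (a₁₁ A * a₁₂ B + a₁₂ A * a₂₂ B)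
              (a₂₁ A * a₁₁ B + a₂₂ A * a₂₁ B) (a₂₁ A * a₁₂ B + a₂₂ A * a₂₂ B)

  𝟘 𝟙 : M₂
  𝟘 = mat 0# 0# 0# 0#
  𝟙 = mat 1# 0# 0# 1#

  Idempotent : M₂ → Set
  Idempotent e = (e · e) ≈M e

  NontrivialIdempotent : M₂ → Set
  NontrivialIdempotent e = Idempotent e × ¬ (e ≈M 𝟘) × ¬ (e ≈M 𝟙)

  -- An enumeration of the vertex set of G_Id(M₂(F)): every member is a
  -- nontrivial idempotent, every nontrivial idempotent occurs, and no
  -- two entries are equal.
  record VertexEnum : Set where
    field
      verts     : List M₂
      sound     : ∀ i → NontrivialIdempotent (lookup verts i)
      complete  : ∀ e → NontrivialIdempotent e → Any (e ≈M_) verts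
      distinct  : AllPairs (λ h k → ¬ (h ≈M k)) verts

    m : ℕ
    m = length verts

    V : Fin m → M₂
    V = lookup verts

    Adj : Fin m → Fin m → Set
    Adj i j = i ≢ j × ((V i · V j) ≈M 𝟘 ⊎ (V j · V i) ≈M 𝟘)

    data Walk : Fin m → Fin m → ℕ → Set where
      here : ∀ {i} → Walk i i 0
      step : ∀ {i j k l} → Adj i j → Walk j k l → Walk i k (suc l)

    -- dist is the graph distance (this also forces connectedness)
    IsDistance : (Fin m → Fin m → ℕ) → Set
    IsDistance d = ∀ i j → Walk i j (d i j) × (∀ l → Walk i j l → d i j ≤ l)

    Σℚ : List ℚ → ℚ
    Σℚ = foldr ℚ._+_ 0ℚ

    ℕ→ℚ : ℕ → ℚ
    ℕ→ℚ k = + k ℚ./ 1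

    -- 1/d, only applied to d(u,v) with u ≠ v, where d ≥ 1
    inv : ℕ → ℚ
    inv zero    = 0ℚ
    inv (suc k) = + 1 ℚ./ suc k

    dG : (Fin m → Fin m → ℕ) → Fin m → ℚ
    dG d v = Σℚ (map (λ u → ℕ→ℚ (d u v)) (allFin m))

    d'G : (Fin m → Fin m → ℕ) → Fin m → ℚ
    d'G d v = Σℚ (map (λ u → if does (u Fin.≟ v) then 0ℚ else inv (d u v)) (allFin m))

    wiener : (Fin m → Fin m → ℕ) → ℚ
    wiener d = ℚ.½ ℚ.* Σℚ (map (dG d) (allFin m))

    harary : (Fin m → Fin m → ℕ) → ℚ
    harary d = Σℚ (map (d'G d) (allFin m))

-- A nontrivial idempotent of M₂(F) has rank one, so it is the projector onto a line p
-- along a line q ≠ p, and every pair of distinct points (p , q) of the projective line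
-- P¹(F) arises exactly once: G_Id(M₂(F)) has (n + 1) n vertices.  Two such projectors
-- multiply to zero exactly when the image of the second is the kernel of the first, so
-- (a , b) and (p , q) are adjacent iff p = b or a = q, and non-adjacent vertices are
-- joined through (b , p).  Seen from a fixed vertex (p , q) there is therefore one vertex
-- at distance 0, 2n − 1 at distance 1 (the pairs (a , p) and (q , b), with (q , p)
-- counted twice) and n² − n at distance 2; W and H are n(n + 1) times these column sums.
module Submission where

open import Defs
import Data.Nat as ℕ
open import Data.Fin as Fin using (Fin; zero; suc)
open import Data.List using (List; lookup)
open import Data.List.Membership.Propositional.Properties using (∈-lookup)
import Data.List.Relation.Unary.All as All
open import Data.List.Relation.Unary.AllPairs using (AllPairs; _∷_)
open import Data.List.Relation.Unary.Any using (index)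
open import Data.List.Relation.Unary.Any.Properties using (lookup-index)
open import Data.Product using (∃; _×_; _,_; proj₁; proj₂)
open import Data.Sum using (_⊎_; inj₁; inj₂)
open import Data.Empty using (⊥-elim)
open import Relation.Binary.Core using (Rel)
open import Relation.Binary.Definitions using (Symmetric; Decidable)
open import Relation.Nullary using (¬_; yes; no)
open import Relation.Binary.PropositionalEquality as ≡ using (_≡_; _≢_)

lookup-injective : ∀ {a ℓ} {A : Set a} {R : Rel A ℓ} → Symmetric R → {xs : List A} →
                   AllPairs (λ x y → ¬ R x y) xs → ∀ {i j} → R (lookup xs i) (lookup xs j) → i ≡ j
lookup-injective sym (_ ∷ _)  {zero}  {zero}  _ = ≡.refl
lookup-injective sym (x≉ ∷ _) {zero}  {suc j} r = ⊥-elim (All.lookup x≉ (∈-lookup j) r)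
lookup-injective sym (x≉ ∷ _) {suc i} {zero}  r = ⊥-elim (All.lookup x≉ (∈-lookup i) (sym r))
lookup-injective sym (_ ∷ u)  {suc i} {suc j} r = ≡.cong suc (lookup-injective sym u r)

module Field (F : FiniteField) where
  open FiniteField F hiding (zero)
  open import Algebra.Properties.Ring ring

  element : Fin card → Carrier
  element = lookup elems

  indexOf : Carrier → Fin card
  indexOf x = index (complete x)

  ≈element-indexOf : ∀ x → x ≈ element (indexOf x)
  ≈element-indexOf x = lookup-index (complete x)

  element-injective : ∀ {i j} → element i ≈ element j → i ≡ j
  element-injective = lookup-injective sym distinct

  _≈?_ : Decidable _≈_
  x ≈? y with indexOf x Fin.≟ indexOf y
  ... | yes eq = yes (trans (≈element-indexOf x)
                            (trans (reflexive (≡.cong element eq)) (sym (≈element-indexOf y))))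
  ... | no neq = no λ x≈y → neq (element-injective
                                   (trans (sym (≈element-indexOf x)) (trans x≈y (≈element-indexOf y))))

  1≉0 : ¬ 1# ≈ 0#
  1≉0 1≈0 = 0≉1 (sym 1≈0)

  -- The junk value 0 ⁻¹ = 0 is never relied on.
  _⁻¹ : Carrier → Carrier
  x ⁻¹ with x ≈? 0#
  ... | yes _   = 0#
  ... | no x≉0 = proj₁ (inverse x x≉0)

  x*x⁻¹≈1 : ∀ {x} → ¬ x ≈ 0# → x * x ⁻¹ ≈ 1#
  x*x⁻¹≈1 {x} x≉0 with x ≈? 0#
  ... | yes x≈0 = ⊥-elim (x≉0 x≈0)
  ... | no x≉0′ = proj₂ (inverse x x≉0′)

  open import Algebra.Solver.Ring.NaturalCoefficients.Default commutativeSemiring using (solve; _:=_; _:+_; _:*_)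
  open import Relation.Binary.Reasoning.Setoid setoid

  x⁻¹*[x*y]≈y : ∀ {x} y → ¬ x ≈ 0# → x ⁻¹ * (x * y) ≈ y
  x⁻¹*[x*y]≈y {x} y x≉0 = begin
    x ⁻¹ * (x * y)  ≈⟨ solve 3 (λ x x′ y → x′ :* (x :* y) := (x :* x′) :* y) refl x (x ⁻¹) y ⟩
    x * x ⁻¹ * y    ≈⟨ *-congʳ (x*x⁻¹≈1 x≉0) ⟩
    1# * y          ≈⟨ *-identityˡ y ⟩
    y               ∎

  *-cancelˡ : ∀ {x y z} → ¬ x ≈ 0# → x * y ≈ x * z → y ≈ z
  *-cancelˡ {x} {y} {z} x≉0 xy≈xz = begin
    y               ≈⟨ x⁻¹*[x*y]≈y y x≉0 ⟨
    x ⁻¹ * (x * y)  ≈⟨ *-congˡ xy≈xz ⟩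
    x ⁻¹ * (x * z)  ≈⟨ x⁻¹*[x*y]≈y z x≉0 ⟩
    z               ∎

  x≉0∧x*y≈0⇒y≈0 : ∀ {x y} → ¬ x ≈ 0# → x * y ≈ 0# → y ≈ 0#
  x≉0∧x*y≈0⇒y≈0 {x} x≉0 xy≈0 = *-cancelˡ x≉0 (trans xy≈0 (sym (zeroʳ x)))

  x*y≈1⇒x≉0 : ∀ {x y} → x * y ≈ 1# → ¬ x ≈ 0#
  x*y≈1⇒x≉0 {x} {y} xy≈1 x≈0 = 0≉1 (trans (sym (zeroˡ y)) (trans (*-congʳ (sym x≈0)) xy≈1))

  x*y≈1⇒y≈x⁻¹ : ∀ {x y} → x * y ≈ 1# → y ≈ x ⁻¹
  x*y≈1⇒y≈x⁻¹ xy≈1 = let x≉0 = x*y≈1⇒x≉0 xy≈1 in *-cancelˡ x≉0 (trans xy≈1 (sym (x*x⁻¹≈1 x≉0)))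

  x*x≈x⇒x≈0⊎x≈1 : ∀ {x} → x * x ≈ x → x ≈ 0# ⊎ x ≈ 1#
  x*x≈x⇒x≈0⊎x≈1 {x} xx≈x with x ≈? 0#
  ... | yes x≈0 = inj₁ x≈0
  ... | no x≉0 = inj₂ (*-cancelˡ x≉0 (trans xx≈x (sym (*-identityʳ x))))

  -x*-y≈x*y : ∀ x y → - x * - y ≈ x * y
  -x*-y≈x*y x y = begin
    - x * - y      ≈⟨ -‿distribˡ-* x (- y) ⟨
    - (x * - y)    ≈⟨ -‿cong (-‿distribʳ-* x y) ⟨
    - (- (x * y))  ≈⟨ -‿involutive (x * y) ⟩
    x * y          ∎

  -x*y*-z≈x*y*z : ∀ x y z → - x * y * - z ≈ x * y * z
  -x*y*-z≈x*y*z x y z = trans (*-congʳ (sym (-‿distribˡ-* x y))) (-x*-y≈x*y (x * y) z)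

  x*[y*y⁻¹]≈x : ∀ x {y} → ¬ y ≈ 0# → x * (y * y ⁻¹) ≈ x
  x*[y*y⁻¹]≈x x y≉0 = trans (*-congˡ (x*x⁻¹≈1 y≉0)) (*-identityʳ x)

  -x≈0⇒x≈0 : ∀ {x} → - x ≈ 0# → x ≈ 0#
  -x≈0⇒x≈0 {x} -x≈0 = trans (sym (-‿involutive x)) (trans (-‿cong -x≈0) -0#≈0#)

module Projectors (F : FiniteField) where
  open FiniteField F hiding (zero; complete; distinct)
  open import Algebra.Properties.Ring ring
  open Field F
  open Mat F
  open import Algebra.Solver.Ring.NaturalCoefficients.Default commutativeSemiring using (solve; _:=_; _:+_; _:*_; con)
  open import Relation.Binary.Reasoning.Setoid setoid

  ≈M-refl : ∀ {A} → A ≈M A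
  ≈M-refl = refl , refl , refl , refl

  ≈M-sym : ∀ {A B} → A ≈M B → B ≈M A
  ≈M-sym (p , q , r , s) = sym p , sym q , sym r , sym s

  ≈M-trans : ∀ {A B C} → A ≈M B → B ≈M C → A ≈M C
  ≈M-trans (p , q , r , s) (p′ , q′ , r′ , s′) = trans p p′ , trans q q′ , trans r r′ , trans s s′

  ·-cong : ∀ {A A′ B B′} → A ≈M A′ → B ≈M B′ → (A · B) ≈M (A′ · B′)
  ·-cong (p , q , r , s) (p′ , q′ , r′ , s′) =
    +-cong (*-cong p p′) (*-cong q r′) , +-cong (*-cong p q′) (*-cong q s′) ,
    +-cong (*-cong r p′) (*-cong s r′) , +-cong (*-cong r q′) (*-cong s s′)

  nontrivialIdempotent-trace : ∀ {a b c d} → NontrivialIdempotent (mat a b c d) → a + d ≈ 1#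
  nontrivialIdempotent-trace {a} {b} {c} {d} ((_ , E₂ , E₃ , _) , _ , _) with b ≈? 0# | c ≈? 0#
  ... | no b≉0 | _ = *-cancelˡ b≉0 (begin
    b * (a + d)    ≈⟨ solve 3 (λ a b d → b :* (a :+ d) := a :* b :+ b :* d) refl a b d ⟩
    a * b + b * d  ≈⟨ E₂ ⟩
    b              ≈⟨ *-identityʳ b ⟨
    b * 1#         ∎)
  ... | yes _ | no c≉0 = *-cancelˡ c≉0 (begin
    c * (a + d)    ≈⟨ solve 3 (λ a c d → c :* (a :+ d) := c :* a :+ d :* c) refl a c d ⟩
    c * a + d * c  ≈⟨ E₃ ⟩
    c              ≈⟨ *-identityʳ c ⟨
    c * 1#         ∎)
  nontrivialIdempotent-trace {a} {b} {c} {d} ((E₁ , _ , _ , E₄) , e≉𝟘 , e≉𝟙) | yes b≈0 | yes c≈0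
    with x*x≈x⇒x≈0⊎x≈1 aa≈a | x*x≈x⇒x≈0⊎x≈1 dd≈d
    where
    aa≈a : a * a ≈ a
    aa≈a = trans (sym (trans (+-congˡ (trans (*-congʳ b≈0) (zeroˡ c))) (+-identityʳ _))) E₁
    dd≈d : d * d ≈ d
    dd≈d = trans (sym (trans (+-congʳ (trans (*-congʳ c≈0) (zeroˡ b))) (+-identityˡ _))) E₄
  ... | inj₁ a≈0 | inj₁ d≈0 = ⊥-elim (e≉𝟘 (a≈0 , b≈0 , c≈0 , d≈0))
  ... | inj₁ a≈0 | inj₂ d≈1 = trans (+-cong a≈0 d≈1) (+-identityˡ 1#)
  ... | inj₂ a≈1 | inj₁ d≈0 = trans (+-cong a≈1 d≈0) (+-identityʳ 1#)
  ... | inj₂ a≈1 | inj₂ d≈1 = ⊥-elim (e≉𝟙 (a≈1 , b≈0 , c≈0 , d≈1))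

  nontrivialIdempotent-det : ∀ {a b c d} → NontrivialIdempotent (mat a b c d) → b * c ≈ a * d
  nontrivialIdempotent-det {a} {b} {c} {d} e@((E₁ , _ , _ , _) , _ , _) = +-cancelˡ (a * a) _ _ (begin
    a * a + b * c  ≈⟨ E₁ ⟩
    a              ≈⟨ *-identityʳ a ⟨
    a * 1#         ≈⟨ *-congˡ (nontrivialIdempotent-trace e) ⟨
    a * (a + d)    ≈⟨ distribˡ a a d ⟩
    a * a + a * d  ∎)

  -- Points of P¹(F): zero is the line spanned by (0,1) and suc i the line spanned by
  -- (1, element i); covec q vanishes exactly on q, so projector p q below is the
  -- idempotent with image p and kernel q.
  Point : Set
  Point = Fin (ℕ.suc card)

  affine : Carrier → Point
  affine x = suc (indexOf x)

  vec₁ vec₂ covec₁ covec₂ : Point → Carrier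
  vec₁ zero    = 0#
  vec₁ (suc i) = 1#
  vec₂ zero    = 1#
  vec₂ (suc i) = element i
  covec₁ zero    = 1#
  covec₁ (suc j) = element j
  covec₂ zero    = 0#
  covec₂ (suc j) = - 1#

  ⟨_∣_⟩ : Point → Point → Carrier
  ⟨ q ∣ p ⟩ = covec₁ q * vec₁ p + covec₂ q * vec₂ p

  ⟨p∣p⟩≈0 : ∀ p → ⟨ p ∣ p ⟩ ≈ 0#
  ⟨p∣p⟩≈0 zero = begin
    1# * 0# + 0# * 1#  ≈⟨ +-cong (zeroʳ 1#) (zeroˡ 1#) ⟩
    0# + 0#            ≈⟨ +-identityˡ 0# ⟩
    0#                 ∎
  ⟨p∣p⟩≈0 (suc i) = begin
    element i * 1# + - 1# * element i  ≈⟨ +-cong (*-identityʳ _) (-1*x≈-x _) ⟩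
    element i - element i              ≈⟨ -‿inverseʳ _ ⟩
    0#                                 ∎

  ⟨q∣p⟩≈0⇒p≡q : ∀ q p → ⟨ q ∣ p ⟩ ≈ 0# → p ≡ q
  ⟨q∣p⟩≈0⇒p≡q zero    zero    _ = ≡.refl
  ⟨q∣p⟩≈0⇒p≡q zero    (suc i) h = ⊥-elim (1≉0 (begin
    1#                         ≈⟨ solve 1 (λ x → con 1 := con 1 :* con 1 :+ con 0 :* x) refl (element i) ⟩
    1# * 1# + 0# * element i   ≈⟨ h ⟩
    0#                         ∎))
  ⟨q∣p⟩≈0⇒p≡q (suc j) zero    h = ⊥-elim (1≉0 (-x≈0⇒x≈0 (begin
    - 1#                        ≈⟨ solve 2 (λ x y → y := x :* con 0 :+ y :* con 1) refl (element j) (- 1#) ⟩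
    element j * 0# + - 1# * 1#  ≈⟨ h ⟩
    0#                          ∎)))
  ⟨q∣p⟩≈0⇒p≡q (suc j) (suc i) h = ≡.cong suc (element-injective (sym (x∙y⁻¹≈ε⇒x≈y _ _ (begin
    element j - element i               ≈⟨ +-cong (*-identityʳ _) (-1*x≈-x _) ⟨
    element j * 1# + - 1# * element i   ≈⟨ h ⟩
    0#                                  ∎))))

  outer : Carrier → Point → Point → M₂
  outer k p q = mat (k * vec₁ p * covec₁ q) (k * vec₁ p * covec₂ q)
                    (k * vec₂ p * covec₁ q) (k * vec₂ p * covec₂ q)

  outer-cong : ∀ {k k′} p q → k ≈ k′ → outer k p q ≈M outer k′ p q
  outer-cong {k} {k′} p q k≈k′ = scale (vec₁ p) (covec₁ q) , scale (vec₁ p) (covec₂ q) ,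
                                 scale (vec₂ p) (covec₁ q) , scale (vec₂ p) (covec₂ q)
    where
    scale : ∀ x y → k * x * y ≈ k′ * x * y
    scale x y = *-congʳ (*-congʳ k≈k′)

  outer-· : ∀ k a b k′ c d → (outer k a b · outer k′ c d) ≈M outer (k * k′ * ⟨ b ∣ c ⟩) a d
  outer-· k a b k′ c d = entry (vec₁ a) (covec₁ d) , entry (vec₁ a) (covec₂ d) ,
                         entry (vec₂ a) (covec₁ d) , entry (vec₂ a) (covec₂ d)
    where
    entry : ∀ x y → k * x * covec₁ b * (k′ * vec₁ c * y) + k * x * covec₂ b * (k′ * vec₂ c * y)
                    ≈ k * k′ * ⟨ b ∣ c ⟩ * x * y
    entry = solve 8 (λ k k′ w₁ w₂ v₁ v₂ x y →
                       k :* x :* w₁ :* (k′ :* v₁ :* y) :+ k :* x :* w₂ :* (k′ :* v₂ :* y)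
                    := k :* k′ :* (w₁ :* v₁ :+ w₂ :* v₂) :* x :* y)
                  refl k k′ (covec₁ b) (covec₂ b) (vec₁ c) (vec₂ c)

  outer-zero : ∀ p q → outer 0# p q ≈M 𝟘
  outer-zero p q = zero-entry (vec₁ p) (covec₁ q) , zero-entry (vec₁ p) (covec₂ q) ,
                   zero-entry (vec₂ p) (covec₁ q) , zero-entry (vec₂ p) (covec₂ q)
    where
    zero-entry : ∀ x y → 0# * x * y ≈ 0#
    zero-entry x y = trans (*-congʳ (zeroˡ x)) (zeroˡ y)

  unit-entry-injective : ∀ {k k′} → k * 1# * 1# ≈ k′ * 1# * 1# → k ≈ k′
  unit-entry-injective h = trans (sym (k*1*1≈k _)) (trans h (k*1*1≈k _))
    where
    k*1*1≈k : ∀ k → k * 1# * 1# ≈ k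
    k*1*1≈k k = trans (*-identityʳ _) (*-identityʳ k)

  negated-unit-entry-injective : ∀ {k k′} → k * 1# * - 1# ≈ k′ * 1# * - 1# → k ≈ k′
  negated-unit-entry-injective h =
    unit-entry-injective (-‿injective (trans (-‿distribʳ-* _ 1#) (trans h (sym (-‿distribʳ-* _ 1#)))))

  -- Every outer k p q has an entry k * 1 * 1 or k * 1 * -1.
  outer-injective : ∀ {k k′} p q → outer k p q ≈M outer k′ p q → k ≈ k′
  outer-injective zero    zero    (_ , _ , h , _) = unit-entry-injective h
  outer-injective zero    (suc _) (_ , _ , _ , h) = negated-unit-entry-injective h
  outer-injective (suc _) zero    (h , _ , _ , _) = unit-entry-injective h
  outer-injective (suc _) (suc _) (_ , h , _ , _) = negated-unit-entry-injective h

  outer≈𝟘⇒k≈0 : ∀ {k} p q → outer k p q ≈M 𝟘 → k ≈ 0#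
  outer≈𝟘⇒k≈0 p q h = outer-injective p q (≈M-trans h (≈M-sym (outer-zero p q)))

  outer≉𝟙 : ∀ k p q → ¬ outer k p q ≈M 𝟙
  outer≉𝟙 k p q (h₁₁ , h₁₂ , h₂₁ , h₂₂) = 1≉0 (begin
    1#       ≈⟨ *-identityʳ 1# ⟨
    1# * 1#  ≈⟨ *-cong h₁₁ h₂₂ ⟨
    k * vec₁ p * covec₁ q * (k * vec₂ p * covec₂ q)  ≈⟨ det≈0 ⟩
    k * vec₁ p * covec₂ q * (k * vec₂ p * covec₁ q)  ≈⟨ *-cong h₁₂ h₂₁ ⟩
    0# * 0#  ≈⟨ zeroˡ 0# ⟩
    0#       ∎)
    where
    det≈0 : k * vec₁ p * covec₁ q * (k * vec₂ p * covec₂ q) ≈ k * vec₁ p * covec₂ q * (k * vec₂ p * covec₁ q)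
    det≈0 = solve 5 (λ k v₁ v₂ w₁ w₂ → k :* v₁ :* w₁ :* (k :* v₂ :* w₂) := k :* v₁ :* w₂ :* (k :* v₂ :* w₁))
                    refl k (vec₁ p) (vec₂ p) (covec₁ q) (covec₂ q)

  projector : Point → Point → M₂
  projector p q = outer (⟨ q ∣ p ⟩ ⁻¹) p q

  ⟨q∣p⟩≉0 : ∀ {p q} → p ≢ q → ¬ ⟨ q ∣ p ⟩ ≈ 0#
  ⟨q∣p⟩≉0 {p} {q} p≢q h = p≢q (⟨q∣p⟩≈0⇒p≡q q p h)

  ⟨q∣p⟩⁻¹≉0 : ∀ {p q} → p ≢ q → ¬ ⟨ q ∣ p ⟩ ⁻¹ ≈ 0#
  ⟨q∣p⟩⁻¹≉0 p≢q = x*y≈1⇒x≉0 (trans (*-comm _ _) (x*x⁻¹≈1 (⟨q∣p⟩≉0 p≢q)))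

  projector-idempotent : ∀ {p q} → p ≢ q → Idempotent (projector p q)
  projector-idempotent {p} {q} p≢q = ≈M-trans (outer-· κ p q κ p q) (outer-cong p q (begin
    κ * κ * ⟨ q ∣ p ⟩    ≈⟨ solve 2 (λ κ P → κ :* κ :* P := κ :* (P :* κ)) refl κ ⟨ q ∣ p ⟩ ⟩
    κ * (⟨ q ∣ p ⟩ * κ)  ≈⟨ *-congˡ (x*x⁻¹≈1 (⟨q∣p⟩≉0 p≢q)) ⟩
    κ * 1#               ≈⟨ *-identityʳ κ ⟩
    κ                    ∎))
    where κ = ⟨ q ∣ p ⟩ ⁻¹

  projector-nontrivialIdempotent : ∀ {p q} → p ≢ q → NontrivialIdempotent (projector p q)
  projector-nontrivialIdempotent {p} {q} p≢q =
    projector-idempotent p≢q , (λ h → ⟨q∣p⟩⁻¹≉0 p≢q (outer≈𝟘⇒k≈0 p q h)) , outer≉𝟙 _ p q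

  projector·projector≈𝟘 : ∀ a b {c} d → c ≡ b → (projector a b · projector c d) ≈M 𝟘
  projector·projector≈𝟘 a b d ≡.refl = ≈M-trans (outer-· _ a b _ b d)
    (≈M-trans (outer-cong a d (trans (*-congˡ (⟨p∣p⟩≈0 b)) (zeroʳ _))) (outer-zero a d))

  projector·projector≈𝟘⇒ : ∀ {a b c d} → a ≢ b → c ≢ d → (projector a b · projector c d) ≈M 𝟘 → c ≡ b
  projector·projector≈𝟘⇒ {a} {b} {c} {d} a≢b c≢d h = ⟨q∣p⟩≈0⇒p≡q b c
    (x≉0∧x*y≈0⇒y≈0 κκ′≉0 (outer≈𝟘⇒k≈0 a d (≈M-trans (≈M-sym (outer-· _ a b _ c d)) h)))
    where
    κκ′≉0 : ¬ ⟨ b ∣ a ⟩ ⁻¹ * ⟨ d ∣ c ⟩ ⁻¹ ≈ 0#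
    κκ′≉0 z = ⟨q∣p⟩⁻¹≉0 c≢d (x≉0∧x*y≈0⇒y≈0 (⟨q∣p⟩⁻¹≉0 a≢b) z)

  another : Point → Point
  another zero    = affine 0#
  another (suc _) = zero

  another-≢ : ∀ p → another p ≢ p
  another-≢ zero    ()
  another-≢ (suc _) ()

  -- A projector is determined by which projectors it annihilates on either side.
  projector-injective : ∀ {a b c d} → c ≢ d → projector a b ≈M projector c d → (a , b) ≡ (c , d)
  projector-injective {a} {b} {c} {d} c≢d h = ≡.cong₂ _,_ (≡.sym c≡a) b≡d
    where
    c≡a : c ≡ a
    c≡a = projector·projector≈𝟘⇒ (another-≢ a) c≢d
            (≈M-trans (·-cong ≈M-refl (≈M-sym h)) (projector·projector≈𝟘 (another a) a b ≡.refl))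
    b≡d : b ≡ d
    b≡d = projector·projector≈𝟘⇒ c≢d (λ b≡o → another-≢ b (≡.sym b≡o))
            (≈M-trans (·-cong (≈M-sym h) ≈M-refl) (projector·projector≈𝟘 a b (another b) ≡.refl))

  rankOne⇒projector : ∀ {e k p q} → Idempotent e → ¬ e ≈M 𝟘 → e ≈M outer k p q →
                      p ≢ q × e ≈M projector p q
  rankOne⇒projector {e} {k} {p} {q} ee≈e e≉𝟘 e≈kpq = p≢q , ≈M-trans e≈kpq (outer-cong p q k≈P⁻¹)
    where
    k≉0 : ¬ k ≈ 0#
    k≉0 k≈0 = e≉𝟘 (≈M-trans e≈kpq (≈M-trans (outer-cong p q k≈0) (outer-zero p q)))
    kkP≈k : k * k * ⟨ q ∣ p ⟩ ≈ k
    kkP≈k = outer-injective p q (≈M-trans (≈M-sym (outer-· k p q k p q))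
              (≈M-trans (·-cong (≈M-sym e≈kpq) (≈M-sym e≈kpq)) (≈M-trans ee≈e e≈kpq)))
    Pk≈1 : ⟨ q ∣ p ⟩ * k ≈ 1#
    Pk≈1 = *-cancelˡ k≉0 (begin
      k * (⟨ q ∣ p ⟩ * k)  ≈⟨ solve 2 (λ k P → k :* (P :* k) := k :* k :* P) refl k ⟨ q ∣ p ⟩ ⟩
      k * k * ⟨ q ∣ p ⟩    ≈⟨ kkP≈k ⟩
      k                    ≈⟨ *-identityʳ k ⟨
      k * 1#               ∎)
    p≢q : p ≢ q
    p≢q ≡.refl = x*y≈1⇒x≉0 Pk≈1 (⟨p∣p⟩≈0 p)
    k≈P⁻¹ : k ≈ ⟨ q ∣ p ⟩ ⁻¹
    k≈P⁻¹ = x*y≈1⇒y≈x⁻¹ Pk≈1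

  rankOne-b≉0 : ∀ {a b c d} → b * c ≈ a * d → ¬ b ≈ 0# →
                mat a b c d ≈M outer (- b) (affine (d * b ⁻¹)) (affine (- (a * b ⁻¹)))
  rankOne-b≉0 {a} {b} {c} {d} det b≉0 = e₁₁ , e₁₂ , e₂₁ , e₂₂
    where
    s = d * b ⁻¹
    t = - (a * b ⁻¹)
    s≈ = ≈element-indexOf s
    t≈ = ≈element-indexOf t
    e₁₁ : a ≈ - b * 1# * element (indexOf t)
    e₁₁ = begin
      a                        ≈⟨ x*[y*y⁻¹]≈x a b≉0 ⟨
      a * (b * b ⁻¹)           ≈⟨ solve 3 (λ a b b′ → a :* (b :* b′) := b :* con 1 :* (a :* b′)) refl a b (b ⁻¹) ⟩
      b * 1# * (a * b ⁻¹)      ≈⟨ -x*y*-z≈x*y*z b 1# _ ⟨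
      - b * 1# * t             ≈⟨ *-congˡ t≈ ⟩
      - b * 1# * element (indexOf t) ∎
    e₁₂ : b ≈ - b * 1# * - 1#
    e₁₂ = sym (trans (-x*y*-z≈x*y*z b 1# 1#) (trans (*-identityʳ _) (*-identityʳ b)))
    e₂₁ : c ≈ - b * element (indexOf s) * element (indexOf t)
    e₂₁ = begin
      c
        ≈⟨ x*[y*y⁻¹]≈x c b≉0 ⟨
      c * (b * b ⁻¹)
        ≈⟨ solve 3 (λ b c b′ → c :* (b :* b′) := b :* c :* b′ :* con 1) refl b c (b ⁻¹) ⟩
      b * c * b ⁻¹ * 1#
        ≈⟨ *-cong (*-congʳ det) (sym (x*x⁻¹≈1 b≉0)) ⟩
      a * d * b ⁻¹ * (b * b ⁻¹)
        ≈⟨ solve 4 (λ a b b′ d → a :* d :* b′ :* (b :* b′) := b :* (d :* b′) :* (a :* b′)) refl a b (b ⁻¹) d ⟩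
      b * s * (a * b ⁻¹)
        ≈⟨ -x*y*-z≈x*y*z b s _ ⟨
      - b * s * t
        ≈⟨ *-cong (*-congˡ s≈) t≈ ⟩
      - b * element (indexOf s) * element (indexOf t) ∎
    e₂₂ : d ≈ - b * element (indexOf s) * - 1#
    e₂₂ = begin
      d                        ≈⟨ x*[y*y⁻¹]≈x d b≉0 ⟨
      d * (b * b ⁻¹)           ≈⟨ solve 3 (λ b b′ d → d :* (b :* b′) := b :* (d :* b′) :* con 1) refl b (b ⁻¹) d ⟩
      b * s * 1#               ≈⟨ -x*y*-z≈x*y*z b s 1# ⟨
      - b * s * - 1#           ≈⟨ *-congʳ (*-congˡ s≈) ⟩
      - b * element (indexOf s) * - 1# ∎

  rankOne-b≈0-d≈0 : ∀ {a b c d} → a ≈ 1# → b ≈ 0# → d ≈ 0# → mat a b c d ≈M outer 1# (affine c) zero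
  rankOne-b≈0-d≈0 {c = c} a≈1 b≈0 d≈0 =
    trans a≈1 (sym (trans (*-identityʳ _) (*-identityʳ 1#))) ,
    trans b≈0 (sym (zeroʳ _)) ,
    trans (≈element-indexOf c) (sym (trans (*-identityʳ _) (*-identityˡ _))) ,
    trans d≈0 (sym (zeroʳ _))

  rankOne-a≈0-b≈0 : ∀ {a b c d} → a ≈ 0# → b ≈ 0# → d ≈ 1# → mat a b c d ≈M outer (- 1#) zero (affine (- c))
  rankOne-a≈0-b≈0 {c = c} a≈0 b≈0 d≈1 =
    trans a≈0 (sym (trans (*-congʳ (zeroʳ _)) (zeroˡ _))) ,
    trans b≈0 (sym (trans (*-congʳ (zeroʳ _)) (zeroˡ _))) ,
    (begin
      c                                  ≈⟨ trans (*-congʳ (*-identityʳ 1#)) (*-identityˡ c) ⟨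
      1# * 1# * c                        ≈⟨ -x*y*-z≈x*y*z 1# 1# c ⟨
      - 1# * 1# * - c                    ≈⟨ *-congˡ (≈element-indexOf (- c)) ⟩
      - 1# * 1# * element (indexOf (- c)) ∎) ,
    trans d≈1 (sym (trans (-x*y*-z≈x*y*z 1# 1# 1#) (trans (*-identityʳ _) (*-identityʳ 1#))))

  nontrivialIdempotent⇒rankOne : ∀ e → NontrivialIdempotent e → ∃ λ k → ∃ λ p → ∃ λ q → e ≈M outer k p q
  nontrivialIdempotent⇒rankOne (mat a b c d) e with b ≈? 0# | a ≈? 0#
  ... | no b≉0 | _ = - b , affine (d * b ⁻¹) , affine (- (a * b ⁻¹)) , rankOne-b≉0 (nontrivialIdempotent-det e) b≉0
  ... | yes b≈0 | no a≉0 = 1# , affine c , zero , rankOne-b≈0-d≈0 a≈1 b≈0 d≈0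
    where
    d≈0 : d ≈ 0#
    d≈0 = x≉0∧x*y≈0⇒y≈0 a≉0 (trans (sym (nontrivialIdempotent-det e)) (trans (*-congʳ b≈0) (zeroˡ c)))
    a≈1 : a ≈ 1#
    a≈1 = trans (sym (trans (+-congˡ d≈0) (+-identityʳ a))) (nontrivialIdempotent-trace e)
  ... | yes b≈0 | yes a≈0 = - 1# , zero , affine (- c) , rankOne-a≈0-b≈0 a≈0 b≈0 d≈1
    where
    d≈1 : d ≈ 1#
    d≈1 = trans (sym (trans (+-congʳ a≈0) (+-identityˡ d))) (nontrivialIdempotent-trace e)

  nontrivialIdempotent⇒projector : ∀ e → NontrivialIdempotent e → ∃ λ p → ∃ λ q → p ≢ q × e ≈M projector p q
  nontrivialIdempotent⇒projector e nti@(ee≈e , e≉𝟘 , _) with nontrivialIdempotent⇒rankOne e nti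
  ... | _ , p , q , e≈outer = p , q , rankOne⇒projector ee≈e e≉𝟘 e≈outer

module Counting where
  open import Data.Nat using (ℕ; zero; suc; _+_; _*_)
  open import Data.Nat.Properties using (+-*-semiring; +-identityʳ; *-identityʳ; *-comm; *-assoc; *-distribˡ-+; suc-injective)
  open import Data.Nat.Tactic.RingSolver using (solve-∀)
  open import Algebra.Properties.Semiring.Sum +-*-semiring
    using (sum-syntax; sum-cong-≗; sum-replicate-zero; ∑-distrib-+; ∑-comm; *-distribˡ-sum; *-distribʳ-sum)
  open import Data.Bool using (true; false; if_then_else_; _∧_; _∨_)
  open import Relation.Nullary using (does)
  open ≡ using (refl; sym; trans; cong; cong₂)
  open ≡.≡-Reasoning

  δ ν : ∀ {k} → Fin k → Fin k → ℕ
  δ i j = if does (i Fin.≟ j) then 1 else 0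
  ν i j = if does (i Fin.≟ j) then 0 else 1

  δ-refl : ∀ {k} (i : Fin k) → δ i i ≡ 1
  δ-refl zero    = refl
  δ-refl (suc i) = δ-refl i

  δ-≢ : ∀ {k} {i j : Fin k} → i ≢ j → δ i j ≡ 0
  δ-≢ {i = i} {j} i≢j with i Fin.≟ j
  ... | yes i≡j = ⊥-elim (i≢j i≡j)
  ... | no _    = refl

  ν-≢ : ∀ {k} {i j : Fin k} → i ≢ j → ν i j ≡ 1
  ν-≢ {i = i} {j} i≢j with i Fin.≟ j
  ... | yes i≡j = ⊥-elim (i≢j i≡j)
  ... | no _    = refl

  ν-comm : ∀ {k} (i j : Fin k) → ν i j ≡ ν j i
  ν-comm i j with i Fin.≟ j | j Fin.≟ i
  ... | yes _   | yes _   = refl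
  ... | no _    | no _    = refl
  ... | yes i≡j | no j≢i  = ⊥-elim (j≢i (sym i≡j))
  ... | no i≢j  | yes j≡i = ⊥-elim (i≢j (sym j≡i))

  δ+ν≡1 : ∀ {k} (i j : Fin k) → δ i j + ν i j ≡ 1
  δ+ν≡1 i j with i Fin.≟ j
  ... | yes _ = refl
  ... | no _  = refl

  ∑-const : ∀ k c → ∑[ i < k ] c ≡ k * c
  ∑-const zero    c = refl
  ∑-const (suc k) c = cong (c +_) (∑-const k c)

  ∑-δ : ∀ {k} (f : Fin k → ℕ) j → ∑[ i < k ] (δ i j * f i) ≡ f j
  ∑-δ {suc k} f zero    = trans (cong₂ _+_ (+-identityʳ (f zero)) (sum-replicate-zero k)) (+-identityʳ (f zero))
  ∑-δ {suc k} f (suc j) = ∑-δ (λ i → f (suc i)) j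

  ∑-sift₂ : ∀ {k} (g : Fin k × Fin k → ℕ) x y → ∑[ a < k ] ∑[ b < k ] (δ a x * (δ b y * g (a , b))) ≡ g (x , y)
  ∑-sift₂ {k} g x y = begin
    ∑[ a < k ] ∑[ b < k ] (δ a x * (δ b y * g (a , b)))
      ≡⟨ sum-cong-≗ (λ a → *-distribˡ-sum (δ a x) (λ b → δ b y * g (a , b))) ⟨
    ∑[ a < k ] (δ a x * ∑[ b < k ] (δ b y * g (a , b)))
      ≡⟨ ∑-δ (λ a → ∑[ b < k ] (δ b y * g (a , b))) x ⟩
    ∑[ b < k ] (δ b y * g (x , b))
      ≡⟨ ∑-δ (λ b → g (x , b)) y ⟩
    g (x , y) ∎

  ∑-ν : ∀ {n} (j : Fin (suc n)) → ∑[ i < suc n ] ν i j ≡ n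
  ∑-ν {n} j = suc-injective (begin
    1 + ∑ν
      ≡⟨ cong (_+ ∑ν) (∑-δ (λ _ → 1) j) ⟨
    ∑[ i < suc n ] (δ i j * 1) + ∑ν
      ≡⟨ ∑-distrib-+ (λ i → δ i j * 1) (λ i → ν i j) ⟨
    ∑[ i < suc n ] (δ i j * 1 + ν i j)
      ≡⟨ sum-cong-≗ (λ i → trans (cong (_+ ν i j) (*-identityʳ (δ i j))) (δ+ν≡1 i j)) ⟩
    ∑[ i < suc n ] 1
      ≡⟨ ∑-const (suc n) 1 ⟩
    suc n * 1
      ≡⟨ *-identityʳ (suc n) ⟩
    suc n ∎)
    where ∑ν = ∑[ i < suc n ] ν i j

  ∑≢ : ∀ {k} → (Fin k → Fin k → ℕ) → ℕ
  ∑≢ {k} g = ∑[ a < k ] ∑[ b < k ] (ν a b * g a b)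

  ∑≢-cong : ∀ {k} {f g : Fin k → Fin k → ℕ} → (∀ a b → f a b ≡ g a b) → ∑≢ f ≡ ∑≢ g
  ∑≢-cong f≗g = sum-cong-≗ (λ a → sum-cong-≗ (λ b → cong (ν a b *_) (f≗g a b)))

  ∑≢-+ : ∀ {k} (f g : Fin k → Fin k → ℕ) → ∑≢ (λ a b → f a b + g a b) ≡ ∑≢ f + ∑≢ g
  ∑≢-+ f g = trans (sum-cong-≗ λ a → trans (sum-cong-≗ (λ b → *-distribˡ-+ (ν a b) (f a b) (g a b)))
                                           (∑-distrib-+ (λ b → ν a b * f a b) (λ b → ν a b * g a b)))
                   (∑-distrib-+ (λ a → ∑[ b < _ ] (ν a b * f a b)) (λ a → ∑[ b < _ ] (ν a b * g a b)))

  ∑≢-1 : ∀ n → ∑≢ {suc n} (λ _ _ → 1) ≡ suc n * n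
  ∑≢-1 n = begin
    ∑≢ {suc n} (λ _ _ → 1)  ≡⟨ sum-cong-≗ (λ a → trans (sum-cong-≗ (λ b → *-identityʳ (ν a b))) (∑-ν′ a)) ⟩
    ∑[ a < suc n ] n        ≡⟨ ∑-const (suc n) n ⟩
    suc n * n               ∎
    where
    ∑-ν′ : ∀ a → ∑[ b < suc n ] ν a b ≡ n
    ∑-ν′ a = trans (sum-cong-≗ (ν-comm a)) (∑-ν a)

  ∑≢-δδ : ∀ {k} (r s : Fin k) → ∑≢ (λ a b → δ a r * δ b s) ≡ ν r s
  ∑≢-δδ {k} r s = begin
    ∑≢ (λ a b → δ a r * δ b s)                     ≡⟨ sum-cong-≗ (λ a → sum-cong-≗ (λ b → reorder (ν a b) (δ a r) (δ b s))) ⟩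
    ∑[ a < k ] ∑[ b < k ] (δ b s * (δ a r * ν a b)) ≡⟨ sum-cong-≗ (λ a → ∑-δ (λ b → δ a r * ν a b) s) ⟩
    ∑[ a < k ] (δ a r * ν a s)                     ≡⟨ ∑-δ (λ a → ν a s) r ⟩
    ν r s                                          ∎
    where
    reorder : ∀ x y z → x * (y * z) ≡ z * (y * x)
    reorder = solve-∀

  ∑≢-δʳ : ∀ {n} (s : Fin (suc n)) → ∑≢ (λ a b → δ b s) ≡ n
  ∑≢-δʳ {n} s = begin
    ∑≢ (λ a b → δ b s)                              ≡⟨ sum-cong-≗ (λ a → sum-cong-≗ (λ b → *-comm (ν a b) (δ b s))) ⟩
    ∑[ a < suc n ] ∑[ b < suc n ] (δ b s * ν a b)   ≡⟨ sum-cong-≗ (λ a → ∑-δ (ν a) s) ⟩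
    ∑[ a < suc n ] ν a s                            ≡⟨ ∑-ν s ⟩
    n                                               ∎

  ∑≢-δˡ : ∀ {n} (r : Fin (suc n)) → ∑≢ (λ a b → δ a r) ≡ n
  ∑≢-δˡ {n} r = begin
    ∑≢ (λ a b → δ a r)                              ≡⟨ sum-cong-≗ (λ a → sum-cong-≗ (λ b → *-comm (ν a b) (δ a r))) ⟩
    ∑[ a < suc n ] ∑[ b < suc n ] (δ a r * ν a b)   ≡⟨ sum-cong-≗ (λ a → *-distribˡ-sum (δ a r) (ν a)) ⟨
    ∑[ a < suc n ] (δ a r * ∑[ b < suc n ] ν a b)   ≡⟨ ∑-δ (λ a → ∑[ b < suc n ] ν a b) r ⟩
    ∑[ b < suc n ] ν r b                            ≡⟨ sum-cong-≗ (ν-comm r) ⟩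
    ∑[ b < suc n ] ν b r                            ≡⟨ ∑-ν r ⟩
    n                                               ∎

  data Position : Set where
    equal adjacent apart : Position

  adjacency : ∀ {k} → Fin k × Fin k → Fin k × Fin k → Position
  adjacency (a , b) (p , q) = if does (b Fin.≟ p) ∨ does (a Fin.≟ q) then adjacent else apart

  position : ∀ {k} → Fin k × Fin k → Fin k × Fin k → Position
  position (a , b) (p , q) = if does (a Fin.≟ p) ∧ does (b Fin.≟ q) then equal else adjacency (a , b) (p , q)

  -- Reading (a , b) as the projector with image a and kernel b, two pairs are
  -- linked exactly when one of the two products of their projectors vanishes.
  Linked : ∀ {k} → Fin k × Fin k → Fin k × Fin k → Set
  Linked (a , b) (p , q) = p ≡ b ⊎ a ≡ q

  data PositionSpec {k} (s t : Fin k × Fin k) : Position → Set where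
    equal    : s ≡ t → PositionSpec s t equal
    adjacent : s ≢ t → Linked s t → PositionSpec s t adjacent
    apart    : s ≢ t → ¬ Linked s t → PositionSpec s t apart

  adjacency-spec : ∀ {k} {s t : Fin k × Fin k} → s ≢ t → PositionSpec s t (adjacency s t)
  adjacency-spec {s = a , b} {p , q} s≢t with b Fin.≟ p | a Fin.≟ q
  ... | yes b≡p | _       = adjacent s≢t (inj₁ (sym b≡p))
  ... | no _    | yes a≡q = adjacent s≢t (inj₂ a≡q)
  ... | no b≢p  | no a≢q  = apart s≢t λ { (inj₁ p≡b) → b≢p (sym p≡b) ; (inj₂ a≡q) → a≢q a≡q }

  position-spec : ∀ {k} (s t : Fin k × Fin k) → PositionSpec s t (position s t)
  position-spec (a , b) (p , q) with a Fin.≟ p | b Fin.≟ q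
  ... | yes refl | yes refl = equal refl
  ... | yes _    | no b≢q   = adjacency-spec (λ s≡t → b≢q (cong proj₂ s≡t))
  ... | no a≢p   | _        = adjacency-spec (λ s≡t → a≢p (cong proj₁ s≡t))

  δₚ : Position → Position → ℕ
  δₚ equal    equal    = 1
  δₚ adjacent adjacent = 1
  δₚ apart    apart    = 1
  δₚ _        _        = 0

  δₚ-partition : ∀ c → δₚ c equal + δₚ c adjacent + δₚ c apart ≡ 1
  δₚ-partition equal    = refl
  δₚ-partition adjacent = refl
  δₚ-partition apart    = refl

  δₚ-adjacency-equal : ∀ {k} (s t : Fin k × Fin k) → δₚ (adjacency s t) equal ≡ 0
  δₚ-adjacency-equal (a , b) (p , q) with does (b Fin.≟ p) ∨ does (a Fin.≟ q)
  ... | true  = refl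
  ... | false = refl

  δₚ-adjacency-adjacent : ∀ {k} (a b p q : Fin k) →
                          δₚ (adjacency (a , b) (p , q)) adjacent + δ b p * δ a q ≡ δ b p + δ a q
  δₚ-adjacency-adjacent a b p q with b Fin.≟ p | a Fin.≟ q
  ... | yes _ | yes _ = refl
  ... | yes _ | no _  = refl
  ... | no _  | yes _ = refl
  ... | no _  | no _  = refl

  δₚ-position-equal : ∀ {k} (a b p q : Fin k) → δₚ (position (a , b) (p , q)) equal ≡ δ a p * δ b q
  δₚ-position-equal a b p q with a Fin.≟ p | b Fin.≟ q
  ... | yes _ | yes _ = refl
  ... | yes _ | no _  = δₚ-adjacency-equal (a , b) (p , q)
  ... | no _  | _     = δₚ-adjacency-equal (a , b) (p , q)

  δₚ-position-adjacent : ∀ {k} {p q : Fin k} → p ≢ q → ∀ a b →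
                         δₚ (position (a , b) (p , q)) adjacent + δ b p * δ a q ≡ δ b p + δ a q
  δₚ-position-adjacent {p = p} {q} p≢q a b with a Fin.≟ p | b Fin.≟ q
  ... | yes refl | yes refl rewrite δ-≢ (λ q≡p → p≢q (sym q≡p)) | δ-≢ p≢q = refl
  ... | yes _    | no _     = δₚ-adjacency-adjacent a b p q
  ... | no _     | _        = δₚ-adjacency-adjacent a b p q

  count : ∀ {k} → Position → Fin k × Fin k → ℕ
  count c t = ∑≢ (λ a b → δₚ (position (a , b) t) c)

  count-equal : ∀ {k} {p q : Fin k} → p ≢ q → count equal (p , q) ≡ 1
  count-equal {p = p} {q} p≢q = trans (∑≢-cong (λ a b → δₚ-position-equal a b p q)) (trans (∑≢-δδ p q) (ν-≢ p≢q))

  -- Inclusion-exclusion: (q , p) satisfies both b = p and a = q.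
  count-adjacent : ∀ {n} {p q : Fin (suc n)} → p ≢ q → count adjacent (p , q) + 1 ≡ n + n
  count-adjacent {n} {p} {q} p≢q = begin
    count adjacent (p , q) + 1
      ≡⟨ cong (count adjacent (p , q) +_) (trans (∑≢-δδ q p) (ν-≢ q≢p)) ⟨
    count adjacent (p , q) + ∑≢ (λ a b → δ a q * δ b p)
      ≡⟨ ∑≢-+ (λ a b → δₚ (position (a , b) (p , q)) adjacent) (λ a b → δ a q * δ b p) ⟨
    ∑≢ (λ a b → δₚ (position (a , b) (p , q)) adjacent + δ a q * δ b p)
      ≡⟨ ∑≢-cong (λ a b → trans (cong (δₚ (position (a , b) (p , q)) adjacent +_) (*-comm (δ a q) (δ b p)))
                                (δₚ-position-adjacent p≢q a b)) ⟩
    ∑≢ (λ a b → δ b p + δ a q)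
      ≡⟨ ∑≢-+ (λ a b → δ b p) (λ a b → δ a q) ⟩
    ∑≢ (λ a b → δ b p) + ∑≢ (λ a b → δ a q)
      ≡⟨ cong₂ _+_ (∑≢-δʳ p) (∑≢-δˡ q) ⟩
    n + n ∎
    where
    q≢p : q ≢ p
    q≢p q≡p = p≢q (sym q≡p)

  count-total : ∀ {n} (t : Fin (suc n) × Fin (suc n)) → count equal t + count adjacent t + count apart t ≡ suc n * n
  count-total {n} t = begin
    count equal t + count adjacent t + count apart t
      ≡⟨ cong (_+ count apart t) (∑≢-+ (λ a b → pos a b equal) (λ a b → pos a b adjacent)) ⟨
    ∑≢ (λ a b → pos a b equal + pos a b adjacent) + count apart t
      ≡⟨ ∑≢-+ (λ a b → pos a b equal + pos a b adjacent) (λ a b → pos a b apart) ⟨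
    ∑≢ (λ a b → pos a b equal + pos a b adjacent + pos a b apart)
      ≡⟨ ∑≢-cong (λ a b → δₚ-partition (position (a , b) t)) ⟩
    ∑≢ {suc n} (λ _ _ → 1)
      ≡⟨ ∑≢-1 n ⟩
    suc n * n ∎
    where
    pos : Fin (suc n) → Fin (suc n) → Position → ℕ
    pos a b = δₚ (position (a , b) t)

  δ*δ≡0-diagonal : ∀ {k} {x y : Fin k} → x ≢ y → ∀ a → δ a x * δ a y ≡ 0
  δ*δ≡0-diagonal {x = x} {y} x≢y a with a Fin.≟ x | a Fin.≟ y
  ... | yes a≡x | yes a≡y = ⊥-elim (x≢y (trans (sym a≡x) a≡y))
  ... | yes _   | no _    = refl
  ... | no _    | _       = refl

  δ*δ≡0 : ∀ {k} {a b x y : Fin k} → (x , y) ≢ (a , b) → δ a x * δ b y ≡ 0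
  δ*δ≡0 {a = a} {b} {x} {y} xy≢ab with a Fin.≟ x | b Fin.≟ y
  ... | yes a≡x | yes b≡y = ⊥-elim (xy≢ab (cong₂ _,_ (sym a≡x) (sym b≡y)))
  ... | yes _   | no _    = refl
  ... | no _    | _       = refl

  module _ {m k} (ψ : Fin m → Fin k × Fin k)
           (ψ-injective : ∀ {u v} → ψ u ≡ ψ v → u ≡ v)
           (ψ-offDiagonal : ∀ u → proj₁ (ψ u) ≢ proj₂ (ψ u))
           (ψ-onto : ∀ {a b} → a ≢ b → ∃ λ u → ψ u ≡ (a , b)) where

    ∑-fibre : ∀ a b → ∑[ u < m ] (δ a (proj₁ (ψ u)) * δ b (proj₂ (ψ u))) ≡ ν a b
    ∑-fibre a b with a Fin.≟ b
    ... | yes refl = trans (sum-cong-≗ (λ u → δ*δ≡0-diagonal (ψ-offDiagonal u) a)) (sum-replicate-zero m)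
    ... | no a≢b with ψ-onto a≢b
    ...   | u₀ , ψu₀≡ab = trans (sum-cong-≗ fibre-indicator) (∑-δ (λ _ → 1) u₀)
      where
      fibre-indicator : ∀ u → δ a (proj₁ (ψ u)) * δ b (proj₂ (ψ u)) ≡ δ u u₀ * 1
      fibre-indicator u with u Fin.≟ u₀
      ... | yes refl rewrite ψu₀≡ab | δ-refl a | δ-refl b = refl
      ... | no u≢u₀ = δ*δ≡0 (λ ψu≡ab → u≢u₀ (ψ-injective (trans ψu≡ab (sym ψu₀≡ab))))

    ∑-transfer : ∀ (g : Fin k × Fin k → ℕ) → ∑[ u < m ] g (ψ u) ≡ ∑≢ (λ a b → g (a , b))
    ∑-transfer g = begin
      ∑[ u < m ] g (ψ u)
        ≡⟨ sum-cong-≗ (λ u → ∑-sift₂ g (proj₁ (ψ u)) (proj₂ (ψ u))) ⟨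
      ∑[ u < m ] ∑[ a < k ] ∑[ b < k ] (δ a (x u) * (δ b (y u) * g (a , b)))
        ≡⟨ ∑-comm (λ u a → ∑[ b < k ] (δ a (x u) * (δ b (y u) * g (a , b)))) ⟩
      ∑[ a < k ] ∑[ u < m ] ∑[ b < k ] (δ a (x u) * (δ b (y u) * g (a , b)))
        ≡⟨ sum-cong-≗ (λ a → ∑-comm (λ u b → δ a (x u) * (δ b (y u) * g (a , b)))) ⟩
      ∑[ a < k ] ∑[ b < k ] ∑[ u < m ] (δ a (x u) * (δ b (y u) * g (a , b)))
        ≡⟨ sum-cong-≗ (λ a → sum-cong-≗ (λ b → trans (sum-cong-≗ (λ u → sym (*-assoc (δ a (x u)) (δ b (y u)) (g (a , b)))))
                                                     (sym (*-distribʳ-sum (g (a , b)) (λ u → δ a (x u) * δ b (y u)))))) ⟩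
      ∑[ a < k ] ∑[ b < k ] (∑[ u < m ] (δ a (x u) * δ b (y u)) * g (a , b))
        ≡⟨ sum-cong-≗ (λ a → sum-cong-≗ (λ b → cong (_* g (a , b)) (∑-fibre a b))) ⟩
      ∑≢ (λ a b → g (a , b)) ∎
      where
      x y : Fin m → Fin k
      x u = proj₁ (ψ u)
      y u = proj₂ (ψ u)

module RationalSums where
  open import Data.Nat using (ℕ)
  open import Data.Nat.Coprimality using (1-coprimeTo; sym)
  open import Data.Nat.Properties using (+-*-semiring)
  open import Data.Integer as ℤ using (+_)
  import Data.Integer.Properties as ℤ
  open import Data.Rational using (ℚ; 0ℚ; mkℚ; _/_; _+_; _*_)
  open import Data.Rational.Properties using (+-*-commutativeRing; normalize-coprime)
  open import Data.Rational.Solver using (module +-*-Solver)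
  open import Algebra.Bundles using (CommutativeRing)
  open import Algebra.Properties.Semiring.Sum (CommutativeRing.semiring +-*-commutativeRing)
    using (sum-syntax; sum-cong-≗; ∑-distrib-+; *-distribˡ-sum)
  import Algebra.Properties.Semiring.Sum +-*-semiring as ℕΣ
  open import Data.List using (foldr; map; allFin; tabulate)
  open import Data.List.Properties using (map-tabulate)
  open Counting using (Position; equal; adjacent; apart; δₚ)
  open +-*-Solver using (solve; _:=_; _:+_; _:*_; con)
  open ≡ using (refl; cong; cong₂; trans)
  open ≡.≡-Reasoning

  -- Definitionally Mat.VertexEnum.ℕ→ℚ, which is only available inside a vertex enumeration.
  fromℕ : ℕ → ℚ
  fromℕ k = + k / 1

  private
    mkℚ/1 : ℕ → ℚ
    mkℚ/1 a = mkℚ (+ a) 0 (sym (1-coprimeTo a))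

    fromℕ≡mkℚ/1 : ∀ a → fromℕ a ≡ mkℚ/1 a
    fromℕ≡mkℚ/1 a = normalize-coprime (sym (1-coprimeTo a))

  -- The ≡⟨⟩ steps: on denominators 1, _+_ and _*_ reduce to the integer operations followed by _/ 1.
  fromℕ-+ : ∀ a b → fromℕ (a ℕ.+ b) ≡ fromℕ a + fromℕ b
  fromℕ-+ a b = begin
    + (a ℕ.+ b) / 1                        ≡⟨ cong (_/ 1) (ℤ.pos-+ a b) ⟩
    (+ a ℤ.+ + b) / 1                      ≡⟨ cong (_/ 1) (cong₂ ℤ._+_ (ℤ.*-identityʳ (+ a)) (ℤ.*-identityʳ (+ b))) ⟨
    (+ a ℤ.* + 1 ℤ.+ + b ℤ.* + 1) / 1       ≡⟨⟩
    mkℚ/1 a + mkℚ/1 b                      ≡⟨ cong₂ _+_ (fromℕ≡mkℚ/1 a) (fromℕ≡mkℚ/1 b) ⟨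
    fromℕ a + fromℕ b                      ∎

  fromℕ-* : ∀ a b → fromℕ (a ℕ.* b) ≡ fromℕ a * fromℕ b
  fromℕ-* a b = begin
    + (a ℕ.* b) / 1                ≡⟨ cong (_/ 1) (ℤ.pos-* a b) ⟩
    (+ a ℤ.* + b) / 1              ≡⟨⟩
    mkℚ/1 a * mkℚ/1 b              ≡⟨ cong₂ _*_ (fromℕ≡mkℚ/1 a) (fromℕ≡mkℚ/1 b) ⟨
    fromℕ a * fromℕ b              ∎

  fromℕ-sum : ∀ {m} (f : Fin m → ℕ) → fromℕ (ℕΣ.sum f) ≡ ∑[ i < m ] fromℕ (f i)
  fromℕ-sum {ℕ.zero}  f = refl
  fromℕ-sum {ℕ.suc m} f = trans (fromℕ-+ (f zero) _) (cong (λ s → fromℕ (f zero) + s) (fromℕ-sum (λ i → f (suc i))))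

  foldr-map-allFin : ∀ m (f : Fin m → ℚ) → foldr _+_ 0ℚ (map f (allFin m)) ≡ ∑[ i < m ] f i
  foldr-map-allFin m f = trans (cong (foldr _+_ 0ℚ) (map-tabulate (λ i → i) f)) (foldr-tabulate f)
    where
    foldr-tabulate : ∀ {m} (f : Fin m → ℚ) → foldr _+_ 0ℚ (tabulate f) ≡ ∑[ i < m ] f i
    foldr-tabulate {ℕ.zero}  f = refl
    foldr-tabulate {ℕ.suc m} f = cong (λ s → f zero + s) (foldr-tabulate (λ i → f (suc i)))

  ∑-const : ∀ m c → ∑[ i < m ] c ≡ fromℕ m * c
  ∑-const ℕ.zero    c = ≡.sym (solve 1 (λ c → con 0ℚ :* c := con 0ℚ) refl c)
  ∑-const (ℕ.suc m) c = begin
    c + ∑[ i < m ] c         ≡⟨ cong (λ s → c + s) (∑-const m c) ⟩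
    c + fromℕ m * c          ≡⟨ solve 2 (λ c M → c :+ M :* c := (con (fromℕ 1) :+ M) :* c) refl c (fromℕ m) ⟩
    (fromℕ 1 + fromℕ m) * c  ≡⟨ cong (_* c) (fromℕ-+ 1 m) ⟨
    fromℕ (ℕ.suc m) * c      ∎

  ∑-by-position : ∀ {m} (h : Fin m → Position) (f : Position → ℚ) →
                  ∑[ u < m ] f (h u) ≡ f equal    * fromℕ (ℕΣ.sum (λ u → δₚ (h u) equal))
                                     + f adjacent * fromℕ (ℕΣ.sum (λ u → δₚ (h u) adjacent))
                                     + f apart    * fromℕ (ℕΣ.sum (λ u → δₚ (h u) apart))
  ∑-by-position {m} h f = begin
    ∑[ u < m ] f (h u)
      ≡⟨ sum-cong-≗ (λ u → decompose (h u)) ⟩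
    ∑[ u < m ] (term equal u + term adjacent u + term apart u)
      ≡⟨ ∑-distrib-+ (λ u → term equal u + term adjacent u) (term apart) ⟩
    ∑[ u < m ] (term equal u + term adjacent u) + ∑[ u < m ] term apart u
      ≡⟨ cong (_+ ∑[ u < m ] term apart u) (∑-distrib-+ (term equal) (term adjacent)) ⟩
    ∑[ u < m ] term equal u + ∑[ u < m ] term adjacent u + ∑[ u < m ] term apart u
      ≡⟨ cong₂ _+_ (cong₂ _+_ (factor equal) (factor adjacent)) (factor apart) ⟩
    f equal * fromℕ (ℕΣ.sum (λ u → δₚ (h u) equal)) + f adjacent * fromℕ (ℕΣ.sum (λ u → δₚ (h u) adjacent))
      + f apart * fromℕ (ℕΣ.sum (λ u → δₚ (h u) apart)) ∎
    where
    term : Position → Fin m → ℚ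
    term c u = f c * fromℕ (δₚ (h u) c)
    factor : ∀ c → ∑[ u < m ] term c u ≡ f c * fromℕ (ℕΣ.sum (λ u → δₚ (h u) c))
    factor c = trans (≡.sym (*-distribˡ-sum (f c) (λ u → fromℕ (δₚ (h u) c))))
                     (cong (f c *_) (≡.sym (fromℕ-sum (λ u → δₚ (h u) c))))
    decompose : ∀ c → f c ≡ f equal * fromℕ (δₚ c equal) + f adjacent * fromℕ (δₚ c adjacent) + f apart * fromℕ (δₚ c apart)
    decompose equal    = solve 3 (λ x y z → x := x :* con (fromℕ 1) :+ y :* con 0ℚ :+ z :* con 0ℚ) refl (f equal) (f adjacent) (f apart)
    decompose adjacent = solve 3 (λ x y z → y := x :* con 0ℚ :+ y :* con (fromℕ 1) :+ z :* con 0ℚ) refl (f equal) (f adjacent) (f apart)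
    decompose apart    = solve 3 (λ x y z → z := x :* con 0ℚ :+ y :* con 0ℚ :+ z :* con (fromℕ 1)) refl (f equal) (f adjacent) (f apart)

open import Data.Nat using (ℕ; z≤n; s≤s)
open import Data.Integer using (+_)
open import Data.Rational using (ℚ; 0ℚ; 1ℚ; _/_; _+_; _-_; _*_; ½)
open import Data.Rational.Properties using (+-*-commutativeRing)
open import Data.Rational.Solver using (module +-*-Solver)
open import Data.List using (map; allFin; foldr)
open import Data.Bool using (if_then_else_)
open import Relation.Nullary using (does)
open import Algebra.Bundles using (CommutativeRing)
open import Algebra.Properties.Semiring.Sum (CommutativeRing.semiring +-*-commutativeRing) using (sum-syntax; sum-cong-≗)
open import Data.Nat.Properties using (+-*-semiring; *-identityʳ)
import Algebra.Properties.Semiring.Sum +-*-semiring as ℕΣ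
open +-*-Solver using (solve; _:=_; _:+_; _:-_; _:*_; con)
open Counting
open RationalSums

module _ {n} {t : Fin (ℕ.suc n) × Fin (ℕ.suc n)} (t-offDiagonal : proj₁ t ≢ proj₂ t) where
  open ≡.≡-Reasoning

  private
    N E A P : ℚ
    N = fromℕ n
    E = fromℕ (count equal t)
    A = fromℕ (count adjacent t)
    P = fromℕ (count apart t)

  fromℕ-count-equal : E ≡ 1ℚ
  fromℕ-count-equal = ≡.cong fromℕ (count-equal t-offDiagonal)

  fromℕ-count-adjacent : A ≡ N + N - 1ℚ
  fromℕ-count-adjacent = begin
    A                                   ≡⟨ solve 1 (λ A → A := A :+ con 1ℚ :- con 1ℚ) ≡.refl A ⟩
    A + 1ℚ - 1ℚ                         ≡⟨ ≡.cong (_- 1ℚ) (fromℕ-+ (count adjacent t) 1) ⟨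
    fromℕ (count adjacent t ℕ.+ 1) - 1ℚ  ≡⟨ ≡.cong (λ k → fromℕ k - 1ℚ) (count-adjacent t-offDiagonal) ⟩
    fromℕ (n ℕ.+ n) - 1ℚ                ≡⟨ ≡.cong (_- 1ℚ) (fromℕ-+ n n) ⟩
    N + N - 1ℚ                          ∎

  fromℕ-count-total : E + A + P ≡ N + N * N
  fromℕ-count-total = begin
    E + A + P
      ≡⟨ ≡.cong (_+ P) (fromℕ-+ (count equal t) (count adjacent t)) ⟨
    fromℕ (count equal t ℕ.+ count adjacent t) + P
      ≡⟨ fromℕ-+ (count equal t ℕ.+ count adjacent t) (count apart t) ⟨
    fromℕ (count equal t ℕ.+ count adjacent t ℕ.+ count apart t)
      ≡⟨ ≡.cong fromℕ (count-total t) ⟩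
    fromℕ (n ℕ.+ n ℕ.* n)
      ≡⟨ fromℕ-+ n (n ℕ.* n) ⟩
    N + fromℕ (n ℕ.* n)
      ≡⟨ ≡.cong (λ x → N + x) (fromℕ-* n n) ⟩
    N + N * N ∎

  fromℕ-count-apart : P ≡ N * N - N
  fromℕ-count-apart = begin
    P
      ≡⟨ solve 3 (λ E A P → P := E :+ A :+ P :- E :- A) ≡.refl E A P ⟩
    E + A + P - E - A
      ≡⟨ ≡.cong (λ x → x - E - A) fromℕ-count-total ⟩
    N + N * N - E - A
      ≡⟨ ≡.cong₂ (λ x y → N + N * N - x - y) fromℕ-count-equal fromℕ-count-adjacent ⟩
    N + N * N - 1ℚ - (N + N - 1ℚ)
      ≡⟨ solve 1 (λ N → N :+ N :* N :- con 1ℚ :- (N :+ N :- con 1ℚ) := N :* N :- N) ≡.refl N ⟩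
    N * N - N ∎

distance : Position → ℕ
distance equal    = 0
distance adjacent = 1
distance apart    = 2

harmonic : Position → ℚ
harmonic equal    = 0ℚ
harmonic adjacent = 1ℚ
harmonic apart    = ½

module IdempotentGraph (F : FiniteField) (E : Mat.VertexEnum F) where
  open FiniteField F using (card)
  open Mat F
  open Mat.VertexEnum E
  open Projectors F
  open ≡.≡-Reasoning

  private
    projector-data : ∀ u → ∃ λ p → ∃ λ q → p ≢ q × V u ≈M projector p q
    projector-data u = nontrivialIdempotent⇒projector (V u) (sound u)

  -- ψ u is the (image , kernel) pair of the vertex V u.
  ψ : Fin m → Point × Point
  ψ u = let p , q , _ = projector-data u in p , q

  ψ-offDiagonal : ∀ u → proj₁ (ψ u) ≢ proj₂ (ψ u)
  ψ-offDiagonal u = proj₁ (proj₂ (proj₂ (projector-data u)))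

  V≈projector-ψ : ∀ u → V u ≈M projector (proj₁ (ψ u)) (proj₂ (ψ u))
  V≈projector-ψ u = proj₂ (proj₂ (proj₂ (projector-data u)))

  ψ-injective : ∀ {u v} → ψ u ≡ ψ v → u ≡ v
  ψ-injective {u} {v} ψu≡ψv = lookup-injective ≈M-sym distinct
    (≈M-trans (≡.subst (λ t → V u ≈M projector (proj₁ t) (proj₂ t)) ψu≡ψv (V≈projector-ψ u))
              (≈M-sym (V≈projector-ψ v)))

  ψ-onto : ∀ {a b} → a ≢ b → ∃ λ u → ψ u ≡ (a , b)
  ψ-onto {a} {b} a≢b = u , projector-injective a≢b (≈M-trans (≈M-sym (V≈projector-ψ u)) (≈M-sym projector≈Vu))
    where
    a-b∈verts = complete (projector a b) (projector-nontrivialIdempotent a≢b)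
    u = index a-b∈verts
    projector≈Vu : projector a b ≈M V u
    projector≈Vu = lookup-index a-b∈verts

  V·V≈𝟘⇒ : ∀ {u v} → (V u · V v) ≈M 𝟘 → proj₁ (ψ v) ≡ proj₂ (ψ u)
  V·V≈𝟘⇒ {u} {v} h = projector·projector≈𝟘⇒ (ψ-offDiagonal u) (ψ-offDiagonal v)
    (≈M-trans (·-cong (≈M-sym (V≈projector-ψ u)) (≈M-sym (V≈projector-ψ v))) h)

  V·V≈𝟘⇐ : ∀ {u v} → proj₁ (ψ v) ≡ proj₂ (ψ u) → (V u · V v) ≈M 𝟘
  V·V≈𝟘⇐ {u} {v} c≡b = ≈M-trans (·-cong (V≈projector-ψ u) (V≈projector-ψ v))
                                 (projector·projector≈𝟘 (proj₁ (ψ u)) (proj₂ (ψ u)) (proj₂ (ψ v)) c≡b)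

  Adj⇒Linked : ∀ {u v} → Adj u v → Linked (ψ u) (ψ v)
  Adj⇒Linked (_ , inj₁ uv≈𝟘) = inj₁ (V·V≈𝟘⇒ uv≈𝟘)
  Adj⇒Linked (_ , inj₂ vu≈𝟘) = inj₂ (V·V≈𝟘⇒ vu≈𝟘)

  Linked⇒Adj : ∀ {u v} → u ≢ v → Linked (ψ u) (ψ v) → Adj u v
  Linked⇒Adj u≢v (inj₁ p≡b) = u≢v , inj₁ (V·V≈𝟘⇐ p≡b)
  Linked⇒Adj u≢v (inj₂ a≡q) = u≢v , inj₂ (V·V≈𝟘⇐ a≡q)

  d : Fin m → Fin m → ℕ
  d u v = distance (position (ψ u) (ψ v))

  walk-length-0 : ∀ {i j} → Walk i j 0 → i ≡ j
  walk-length-0 here = ≡.refl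

  walk-length-1 : ∀ {i j} → Walk i j 1 → Adj i j
  walk-length-1 (step i~j here) = i~j

  walk-through-middle : ∀ {i j} → ¬ Linked (ψ i) (ψ j) → Walk i j 2
  walk-through-middle {i} {j} ¬L = step (Linked⇒Adj i≢w (inj₁ (≡.cong proj₁ ψw≡bp)))
                                       (step (Linked⇒Adj w≢j (inj₁ (≡.sym (≡.cong proj₂ ψw≡bp)))) here)
    where
    b≢p : proj₂ (ψ i) ≢ proj₁ (ψ j)
    b≢p b≡p = ¬L (inj₁ (≡.sym b≡p))
    w = proj₁ (ψ-onto b≢p)
    ψw≡bp = proj₂ (ψ-onto b≢p)
    i≢w : i ≢ w
    i≢w i≡w = ψ-offDiagonal i (≡.trans (≡.cong (λ k → proj₁ (ψ k)) i≡w) (≡.cong proj₁ ψw≡bp))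
    w≢j : w ≢ j
    w≢j w≡j = ¬L (inj₁ (≡.trans (≡.cong (λ k → proj₁ (ψ k)) (≡.sym w≡j)) (≡.cong proj₁ ψw≡bp)))

  isDistance : IsDistance d
  isDistance i j with position (ψ i) (ψ j) | position-spec (ψ i) (ψ j)
  ... | equal    | equal ψi≡ψj = ≡.subst (λ k → Walk i k 0) (ψ-injective ψi≡ψj) here , λ _ _ → z≤n
  ... | adjacent | adjacent ψi≢ψj L = step (Linked⇒Adj i≢j L) here , shortest
    where
    i≢j : i ≢ j
    i≢j i≡j = ψi≢ψj (≡.cong ψ i≡j)
    shortest : ∀ l → Walk i j l → 1 ℕ.≤ l
    shortest ℕ.zero    w = ⊥-elim (i≢j (walk-length-0 w))
    shortest (ℕ.suc l) _ = s≤s z≤n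
  ... | apart    | apart ψi≢ψj ¬L = walk-through-middle ¬L , shortest
    where
    shortest : ∀ l → Walk i j l → 2 ℕ.≤ l
    shortest ℕ.zero              w = ⊥-elim (ψi≢ψj (≡.cong ψ (walk-length-0 w)))
    shortest (ℕ.suc ℕ.zero)      w = ⊥-elim (¬L (Adj⇒Linked (walk-length-1 w)))
    shortest (ℕ.suc (ℕ.suc l)) _ = s≤s (s≤s z≤n)

  N : ℚ
  N = fromℕ card

  count-column : ∀ c v → ℕΣ.sum (λ u → δₚ (position (ψ u) (ψ v)) c) ≡ count c (ψ v)
  count-column c v = ∑-transfer ψ ψ-injective ψ-offDiagonal ψ-onto (λ s → δₚ (position s (ψ v)) c)

  ∑-column : ∀ (f : Position → ℚ) v →
             ∑[ u < m ] f (position (ψ u) (ψ v)) ≡ f equal * 1ℚ + f adjacent * (N + N - 1ℚ) + f apart * (N * N - N)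
  ∑-column f v = ≡.trans (∑-by-position (λ u → position (ψ u) (ψ v)) f)
    (≡.cong₂ _+_ (≡.cong₂ _+_ (weight equal (fromℕ-count-equal off)) (weight adjacent (fromℕ-count-adjacent off)))
                 (weight apart (fromℕ-count-apart off)))
    where
    off = ψ-offDiagonal v
    weight : ∀ c {x} → fromℕ (count c (ψ v)) ≡ x → f c * fromℕ (ℕΣ.sum (λ u → δₚ (position (ψ u) (ψ v)) c)) ≡ f c * x
    weight c count≡x = ≡.cong (f c *_) (≡.trans (≡.cong fromℕ (count-column c v)) count≡x)

  distance-column : ∀ v → dG d v ≡ (+ 2 / 1) * N * N - + 1 / 1
  distance-column v = begin
    dG d v
      ≡⟨ foldr-map-allFin m (λ u → fromℕ (d u v)) ⟩
    ∑[ u < m ] fromℕ (distance (position (ψ u) (ψ v)))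
      ≡⟨ ∑-column (λ c → fromℕ (distance c)) v ⟩
    fromℕ 0 * 1ℚ + fromℕ 1 * (N + N - 1ℚ) + fromℕ 2 * (N * N - N)
      ≡⟨ solve 1 (λ N → con (fromℕ 0) :* con 1ℚ :+ con (fromℕ 1) :* (N :+ N :- con 1ℚ) :+ con (fromℕ 2) :* (N :* N :- N)
                         := con (+ 2 / 1) :* N :* N :- con (+ 1 / 1)) ≡.refl N ⟩
    (+ 2 / 1) * N * N - + 1 / 1 ∎

  harary-term : ∀ u v → (if does (u Fin.≟ v) then 0ℚ else inv (d u v)) ≡ harmonic (position (ψ u) (ψ v))
  harary-term u v with u Fin.≟ v | position (ψ u) (ψ v) | position-spec (ψ u) (ψ v)
  ... | yes _   | equal    | _                = ≡.refl
  ... | yes u≡v | adjacent | adjacent ψu≢ψv _ = ⊥-elim (ψu≢ψv (≡.cong ψ u≡v))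
  ... | yes u≡v | apart    | apart ψu≢ψv _    = ⊥-elim (ψu≢ψv (≡.cong ψ u≡v))
  ... | no u≢v  | equal    | equal ψu≡ψv      = ⊥-elim (u≢v (ψ-injective ψu≡ψv))
  ... | no _    | adjacent | _                = ≡.refl
  ... | no _    | apart    | _                = ≡.refl

  harmonic-column : ∀ v → d'G d v ≡ ½ * (N * N + (+ 3 / 1) * N - + 2 / 1)
  harmonic-column v = begin
    d'G d v
      ≡⟨ foldr-map-allFin m _ ⟩
    ∑[ u < m ] (if does (u Fin.≟ v) then 0ℚ else inv (d u v))
      ≡⟨ sum-cong-≗ (λ u → harary-term u v) ⟩
    ∑[ u < m ] harmonic (position (ψ u) (ψ v))
      ≡⟨ ∑-column harmonic v ⟩
    0ℚ * 1ℚ + 1ℚ * (N + N - 1ℚ) + ½ * (N * N - N)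
      ≡⟨ solve 1 (λ N → con 0ℚ :* con 1ℚ :+ con 1ℚ :* (N :+ N :- con 1ℚ) :+ con ½ :* (N :* N :- N)
                         := con ½ :* (N :* N :+ con (+ 3 / 1) :* N :- con (+ 2 / 1))) ≡.refl N ⟩
    ½ * (N * N + (+ 3 / 1) * N - + 2 / 1) ∎

  vertex-count : m ≡ ℕ.suc card ℕ.* card
  vertex-count = begin
    m                            ≡⟨ *-identityʳ m ⟨
    m ℕ.* 1                      ≡⟨ Counting.∑-const m 1 ⟨
    ℕΣ.sum {m} (λ _ → 1)         ≡⟨ ∑-transfer ψ ψ-injective ψ-offDiagonal ψ-onto (λ _ → 1) ⟩
    ∑≢ {ℕ.suc card} (λ _ _ → 1)  ≡⟨ ∑≢-1 card ⟩
    ℕ.suc card ℕ.* card          ∎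

  fromℕ-vertex-count : fromℕ m ≡ N * N + N
  fromℕ-vertex-count = begin
    fromℕ m                         ≡⟨ ≡.cong fromℕ vertex-count ⟩
    fromℕ (card ℕ.+ card ℕ.* card)  ≡⟨ fromℕ-+ card (card ℕ.* card) ⟩
    N + fromℕ (card ℕ.* card)       ≡⟨ ≡.cong (λ x → N + x) (fromℕ-* card card) ⟩
    N + N * N                       ≡⟨ solve 1 (λ N → N :+ N :* N := N :* N :+ N) ≡.refl N ⟩
    N * N + N                       ∎

  wiener-d : wiener d ≡ ½ * ((N * N + N) * ((+ 2 / 1) * N * N - + 1 / 1))
  wiener-d = ≡.cong (½ *_) (begin
    foldr _+_ 0ℚ (map (dG d) (allFin m))  ≡⟨ foldr-map-allFin m (dG d) ⟩
    ∑[ v < m ] dG d v                     ≡⟨ sum-cong-≗ distance-column ⟩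
    ∑[ v < m ] W                          ≡⟨ RationalSums.∑-const m W ⟩
    fromℕ m * W                           ≡⟨ ≡.cong (_* W) fromℕ-vertex-count ⟩
    (N * N + N) * W                       ∎)
    where
    W = (+ 2 / 1) * N * N - + 1 / 1

  harary-d : harary d ≡ ½ * ((N * N + N) * (N * N + (+ 3 / 1) * N - + 2 / 1))
  harary-d = begin
    foldr _+_ 0ℚ (map (d'G d) (allFin m))  ≡⟨ foldr-map-allFin m (d'G d) ⟩
    ∑[ v < m ] d'G d v                     ≡⟨ sum-cong-≗ harmonic-column ⟩
    ∑[ v < m ] (½ * H)                     ≡⟨ RationalSums.∑-const m (½ * H) ⟩
    fromℕ m * (½ * H)                      ≡⟨ ≡.cong (_* (½ * H)) fromℕ-vertex-count ⟩
    (N * N + N) * (½ * H)                  ≡⟨ solve 2 (λ M H → M :* (con ½ :* H) := con ½ :* (M :* H)) ≡.refl (N * N + N) H ⟩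
    ½ * ((N * N + N) * H)                  ∎
    where
    H = N * N + (+ 3 / 1) * N - + 2 / 1

theorem4p3 : (F : FiniteField) (E : Mat.VertexEnum F) →
    let n = + FiniteField.card F / 1
        open Mat.VertexEnum E
    in ∃ λ d → IsDistance d
         × wiener d ≡ ½ * ((n * n + n) * ((+ 2 / 1) * n * n - + 1 / 1))
         × harary d ≡ ½ * ((n * n + n) * (n * n + (+ 3 / 1) * n - + 2 / 1))
theorem4p3 F E = d , isDistance , wiener-d , harary-d
  where open IdempotentGraph F E
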